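{- For all integers $n \ge 1$, $f(n) > 2^{n/2}$. That is, $T(n,k) > 0$ for all integers $k \in [2, 2^{n/2}]$.
   Context: A topology on a finite set $X$ is a collection of subsets of $X$ containing $\emptyset$ and $X$ and closed under unions and finite intersections; its members are open sets. $T(n,k)$ is the number of topologies on $\{1,\dots,n\}$ having exactly $k$ open sets. For an integer $n \ge 1$, $f(n) \ge 2$ is the smallest integer such that there is no topology on an $n$-point set having exactly $f(n)$ open sets. -}

module Defs where

open import Data.Nat using (ℕ)
open import Data.List using (List; length)
open import Data.List.Membership.Propositional using (_∈_)
open import Data.List.Relation.Unary.All using (All)
open import Data.List.Relation.Unary.Unique.Propositional using (Unique)
open import Data.Fin.Subset using (Subset; ⊥; ⊤; _∪_; _∩_; ⋃)
open import Data.Product using (Σ; _×_)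
open import Relation.Binary.PropositionalEquality using (_≡_)

record IsTopology {n : ℕ} (τ : List (Subset n)) : Set where
  field
    noDup     : Unique τ
    empty∈    : ⊥ ∈ τ
    full∈     : ⊤ ∈ τ
    -- closed under unions of any (finite, since X is finite) family of open sets
    ⋃-closed  : (F : List (Subset n)) → All (_∈ τ) F → ⋃ F ∈ τ
    -- closed under (binary, hence finite) intersections
    ∩-closed  : ∀ {U V} → U ∈ τ → V ∈ τ → (U ∩ V) ∈ τ

HasTopologyWith : ℕ → ℕ → Set
HasTopologyWith n k = Σ (List (Subset n)) λ τ → IsTopology τ × length τ ≡ k

-- The indiscrete topology on a nonempty set has 2 open sets. Adjoining an
-- isolated point turns k open sets into 2k, adjoining a dense point (one lying
-- in every nonempty open set) turns k into k + 1. Hence k = 2m is realised on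
-- one point more than m, and k = 2m + 1 on two points more; since k² ≤ 2ⁿ
-- gives m² ≤ 2ⁿ⁻² in both cases, induction on n applies.
module Submission where

open import Defs
open import Data.Nat using (ℕ; zero; suc; _+_; _*_; _^_; _≤_; _<_; z≤n; s≤s)
open import Data.Nat.Properties using (≤-trans; ≤-reflexive; n≤1+n; <⇒≱; *-mono-≤; *-cancelˡ-≤; ^-monoʳ-≤; +-suc)
open import Data.Nat.Solver using (module +-*-Solver)
open import Data.Bool using (false; true; _∨_; _∧_)
open import Data.Vec using (_∷_)
open import Data.Vec.Properties using (∷-injectiveʳ)
open import Data.List using (List; []; _∷_; map; _++_; length)
open import Data.List.Properties using (length-++; length-map)
open import Data.List.Membership.Propositional using (_∈_)
open import Data.List.Membership.Propositional.Properties using (∈-map⁺; ∈-map⁻; ∈-++⁺ˡ; ∈-++⁺ʳ; ∈-++⁻)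
open import Data.List.Relation.Unary.Any using (here; there)
open import Data.List.Relation.Unary.All using (All; []; _∷_; tabulate)
open import Data.List.Relation.Unary.All.Properties as All using ()
open import Data.List.Relation.Unary.AllPairs using ([]; _∷_)
open import Data.List.Relation.Unary.Unique.Propositional using (Unique)
open import Data.List.Relation.Binary.Disjoint.Propositional using (Disjoint)
import Data.List.Relation.Unary.Unique.Propositional.Properties as Unique
open import Data.Fin.Subset using (Subset; ⊥; ⊤; _∪_; _∩_; ⋃)
open import Data.Fin.Subset.Properties using (∩-zeroˡ; ∩-zeroʳ; ∩-identityˡ; ∪-identityˡ; ∪-identityʳ; ∪-zeroˡ)
open import Data.Product using (_,_)
open import Data.Sum using ([_,_]′)
open import Data.Empty using (⊥-elim)
open import Relation.Binary.PropositionalEquality using (_≡_; refl; sym; cong; cong₂; subst; trans)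

module _ {n : ℕ} {τ : List (Subset n)} where

  mkIsTopology : Unique τ → ⊥ ∈ τ → ⊤ ∈ τ →
                 (∀ {U V} → U ∈ τ → V ∈ τ → (U ∪ V) ∈ τ) →
                 (∀ {U V} → U ∈ τ → V ∈ τ → (U ∩ V) ∈ τ) → IsTopology τ
  mkIsTopology noDup ⊥∈ ⊤∈ ∪-closed ∩-closed = record
    { noDup = noDup ; empty∈ = ⊥∈ ; full∈ = ⊤∈ ; ⋃-closed = ⋃-closed ; ∩-closed = ∩-closed }
    where
    ⋃-closed : (F : List (Subset n)) → All (_∈ τ) F → ⋃ F ∈ τ
    ⋃-closed []      []         = ⊥∈
    ⋃-closed (U ∷ F) (U∈ ∷ F∈) = ∪-closed U∈ (⋃-closed F F∈)

  ∪-closed : IsTopology τ → ∀ {U V} → U ∈ τ → V ∈ τ → (U ∪ V) ∈ τ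
  ∪-closed T {U} {V} U∈ V∈ =
    subst (_∈ τ) (cong (U ∪_) (∪-identityʳ V)) (IsTopology.⋃-closed T (U ∷ V ∷ []) (U∈ ∷ V∈ ∷ []))

module Indiscrete (m : ℕ) where

  τ : List (Subset (suc m))
  τ = ⊥ ∷ ⊤ ∷ []

  ∪-closed-τ : ∀ {U V} → U ∈ τ → V ∈ τ → (U ∪ V) ∈ τ
  ∪-closed-τ {V = V} (here refl)         V∈ = subst (_∈ τ) (sym (∪-identityˡ V)) V∈
  ∪-closed-τ {V = V} (there (here refl)) _  = subst (_∈ τ) (sym (∪-zeroˡ V)) (there (here refl))

  ∩-closed-τ : ∀ {U V} → U ∈ τ → V ∈ τ → (U ∩ V) ∈ τ
  ∩-closed-τ {V = V} (here refl)         _  = subst (_∈ τ) (sym (∩-zeroˡ V)) (here refl)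
  ∩-closed-τ {V = V} (there (here refl)) V∈ = subst (_∈ τ) (sym (∩-identityˡ V)) V∈

  isTopology : IsTopology τ
  isTopology = mkIsTopology (((λ ()) ∷ []) ∷ [] ∷ []) (here refl) (there (here refl)) ∪-closed-τ ∩-closed-τ

indiscrete : ∀ m → HasTopologyWith (suc m) 2
indiscrete m = Indiscrete.τ m , Indiscrete.isTopology m , refl

∈-map-∷⁻ : ∀ {n} {τ : List (Subset n)} {b c U} → (b ∷ U) ∈ map (c ∷_) τ → U ∈ τ
∈-map-∷⁻ {c = c} p with ∈-map⁻ (c ∷_) p
... | _ , U∈ , refl = U∈

module IsolatedPoint {n : ℕ} {τ : List (Subset n)} (T : IsTopology τ) where
  open IsTopology T

  τ′ : List (Subset (suc n))
  τ′ = map (false ∷_) τ ++ map (true ∷_) τ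

  lift : ∀ b {U} → U ∈ τ → (b ∷ U) ∈ τ′
  lift false U∈ = ∈-++⁺ˡ (∈-map⁺ (false ∷_) U∈)
  lift true  U∈ = ∈-++⁺ʳ (map (false ∷_) τ) (∈-map⁺ (true ∷_) U∈)

  lower : ∀ {b U} → (b ∷ U) ∈ τ′ → U ∈ τ
  lower p = [ ∈-map-∷⁻ , ∈-map-∷⁻ ]′ (∈-++⁻ (map (false ∷_) τ) p)

  ∪-closed-τ′ : ∀ {U V} → U ∈ τ′ → V ∈ τ′ → (U ∪ V) ∈ τ′
  ∪-closed-τ′ {a ∷ _} {b ∷ _} p q = lift (a ∨ b) (∪-closed T (lower p) (lower q))

  ∩-closed-τ′ : ∀ {U V} → U ∈ τ′ → V ∈ τ′ → (U ∩ V) ∈ τ′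
  ∩-closed-τ′ {a ∷ _} {b ∷ _} p q = lift (a ∧ b) (∩-closed (lower p) (lower q))

  unique : Unique τ′
  unique = Unique.++⁺ (Unique.map⁺ ∷-injectiveʳ noDup) (Unique.map⁺ ∷-injectiveʳ noDup) disjoint
    where
    disjoint : Disjoint (map (false ∷_) τ) (map (true ∷_) τ)
    disjoint (p , q) with ∈-map⁻ (false ∷_) p | ∈-map⁻ (true ∷_) q
    ... | _ , _ , refl | _ , _ , ()

  isTopology : IsTopology τ′
  isTopology = mkIsTopology unique (lift false empty∈) (lift true full∈) ∪-closed-τ′ ∩-closed-τ′

  length-τ′ : length τ′ ≡ length τ + length τ
  length-τ′ = trans (length-++ (map (false ∷_) τ))
                    (cong₂ _+_ (length-map (false ∷_) τ) (length-map (true ∷_) τ))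

module DensePoint {n : ℕ} {τ : List (Subset n)} (T : IsTopology τ) where
  open IsTopology T

  τ′ : List (Subset (suc n))
  τ′ = ⊥ ∷ map (true ∷_) τ

  lift : ∀ {U} → U ∈ τ → (true ∷ U) ∈ τ′
  lift U∈ = there (∈-map⁺ (true ∷_) U∈)

  ∪-closed-τ′ : ∀ {U V} → U ∈ τ′ → V ∈ τ′ → (U ∪ V) ∈ τ′
  ∪-closed-τ′ {V = V} (here refl) V∈          = subst (_∈ τ′) (sym (∪-identityˡ V)) V∈
  ∪-closed-τ′ {U = U} (there p)   (here refl) = subst (_∈ τ′) (sym (∪-identityʳ U)) (there p)
  ∪-closed-τ′ (there p) (there q) with ∈-map⁻ (true ∷_) p | ∈-map⁻ (true ∷_) q
  ... | _ , U∈ , refl | _ , V∈ , refl = lift (∪-closed T U∈ V∈)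

  ∩-closed-τ′ : ∀ {U V} → U ∈ τ′ → V ∈ τ′ → (U ∩ V) ∈ τ′
  ∩-closed-τ′ {V = V} (here refl) _           = subst (_∈ τ′) (sym (∩-zeroˡ V)) (here refl)
  ∩-closed-τ′ {U = U} (there _)   (here refl) = subst (_∈ τ′) (sym (∩-zeroʳ U)) (here refl)
  ∩-closed-τ′ (there p) (there q) with ∈-map⁻ (true ∷_) p | ∈-map⁻ (true ∷_) q
  ... | _ , U∈ , refl | _ , V∈ , refl = lift (∩-closed U∈ V∈)

  unique : Unique τ′
  unique = All.map⁺ (tabulate (λ _ ())) ∷ Unique.map⁺ ∷-injectiveʳ noDup

  isTopology : IsTopology τ′
  isTopology = mkIsTopology unique (here refl) (lift full∈) ∪-closed-τ′ ∩-closed-τ′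

  length-τ′ : length τ′ ≡ suc (length τ)
  length-τ′ = cong suc (length-map (true ∷_) τ)

adjoinIsolatedPoint : ∀ {n k} → HasTopologyWith n k → HasTopologyWith (suc n) (k + k)
adjoinIsolatedPoint (τ , T , refl) = IsolatedPoint.τ′ T , IsolatedPoint.isTopology T , IsolatedPoint.length-τ′ T

adjoinDensePoint : ∀ {n k} → HasTopologyWith n k → HasTopologyWith (suc n) (suc k)
adjoinDensePoint (τ , T , refl) = DensePoint.τ′ T , DensePoint.isTopology T , DensePoint.length-τ′ T

data Parity : ℕ → Set where
  even : ∀ m → Parity (m + m)
  odd  : ∀ m → Parity (suc (m + m))

parity : ∀ k → Parity k
parity zero = even 0
parity (suc k) with parity k
... | even m = odd m
... | odd m  = subst Parity (cong suc (+-suc m m)) (even (suc m))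

square-of-double : ∀ m → (m + m) * (m + m) ≡ 2 * (2 * (m * m))
square-of-double = solve 1 (λ m → (m :+ m) :* (m :+ m) := con 2 :* (con 2 :* (m :* m))) refl
  where open +-*-Solver

halve-square-≤ : ∀ m n → (m + m) * (m + m) ≤ 2 ^ (2 + n) → m * m ≤ 2 ^ n
halve-square-≤ m n h = *-cancelˡ-≤ 2 (*-cancelˡ-≤ 2 (≤-trans (≤-reflexive (sym (square-of-double m))) h))

2<square : ∀ {k} → 2 ≤ k → 2 < k * k
2<square 2≤k = ≤-trans (s≤s (s≤s (s≤s z≤n))) (*-mono-≤ 2≤k 2≤k)

hasTopologyWith : ∀ n k → 2 ≤ k → k * k ≤ 2 ^ n → HasTopologyWith n k
hasTopologyWith n k = byParity n (parity k)
  where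
  byParity : ∀ n {k} → Parity k → 2 ≤ k → k * k ≤ 2 ^ n → HasTopologyWith n k
  byParity zero          _ 2≤k k²≤1 = ⊥-elim (<⇒≱ (2<square 2≤k) (≤-trans k²≤1 (n≤1+n 1)))
  byParity (suc zero)    _ 2≤k k²≤2 = ⊥-elim (<⇒≱ (2<square 2≤k) k²≤2)
  byParity (suc (suc n)) (even zero)          ()
  byParity (suc (suc n)) (even (suc zero))    _ _ = indiscrete (suc n)
  byParity (suc (suc n)) (even m@(suc (suc _))) _ k²≤2ⁿ =
    adjoinIsolatedPoint (hasTopologyWith (suc n) m (s≤s (s≤s z≤n))
      (halve-square-≤ m (suc n) (≤-trans k²≤2ⁿ (^-monoʳ-≤ 2 (n≤1+n (2 + n))))))
  byParity (suc (suc n)) (odd zero)           (s≤s ())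
  byParity (suc (suc n)) (odd (suc zero))     _ _ = adjoinDensePoint (indiscrete n)
  byParity (suc (suc n)) (odd m@(suc (suc _)))  _ k²≤2ⁿ =
    adjoinDensePoint (adjoinIsolatedPoint (hasTopologyWith n m (s≤s (s≤s z≤n))
      (halve-square-≤ m n (≤-trans (*-mono-≤ (n≤1+n (m + m)) (n≤1+n (m + m))) k²≤2ⁿ))))

corollary3p4 : (n : ℕ) → 1 ≤ n → (k : ℕ) → 2 ≤ k → k * k ≤ 2 ^ n →
    HasTopologyWith n k
corollary3p4 n _ k = hasTopologyWith n k
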